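{- Let $k\ge 2$ be an integer and $p_k(X)=X^k-2(X^{k-2}+X^{k-3}+\cdots+X+1)$. For $n\ge k$ let $$R_{2,3,\dots,k}(n)=\sum_{i=1}^{n}X_iX_{i+1}\cdots X_{i+k-1},$$ where indices are taken modulo $n$ with complete residue system $\{1,\dots,n\}$. Then the sequence $\{S(R_{2,3,\dots,k}(n))\}$ satisfies the homogeneous linear recurrence whose characteristic polynomial is $p_k(X)$.
   Context: Boolean functions in $n$ variables are maps $\mathbb{F}_2^n\to\mathbb{F}_2$ written as polynomials in $X_1,\dots,X_n$; $S(F)=\sum_{\mathbf{x}\in\mathbb{F}_2^n}(-1)^{F(\mathbf{x})}$. A sequence satisfies the homogeneous linear recurrence with characteristic polynomial $X^d-\sum_{i=1}^d c_iX^{d-i}$ if $a_n=\sum_{i=1}^d c_ia_{n-i}$ for all admissible $n$. -}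

module Defs where

open import Data.Nat using (ℕ; zero; suc; _+_; _∸_; _≤_; _≡ᵇ_)
open import Data.Nat.DivMod using (_%_; m%n<n)
open import Data.Nat.Properties using ()
open import Data.Fin using (Fin; toℕ; fromℕ<)
open import Data.Bool using (Bool; true; false; _∧_; _xor_; if_then_else_)
open import Data.List using (List; []; _∷_; map; foldr; upTo; allFin; concatMap; _++_)
open import Data.Vec.Functional using (Vector)
import Data.Fin as F
open import Data.Integer using (ℤ; +_; -_; _*_)
import Data.Integer as ℤ
open import Relation.Binary.PropositionalEquality using (_≡_)

-- Points of F₂ⁿ: functions Fin n → Bool (Bool ≅ F₂, true = 1).
Point : ℕ → Set
Point n = Fin n → Bool

BoolFun : ℕ → Set
BoolFun n = Point n → Bool

cons : ∀ {n} → Bool → Point n → Point (suc n)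
cons b x F.zero = b
cons b x (F.suc i) = x i

allPoints : (n : ℕ) → List (Point n)
allPoints zero = (λ ()) ∷ []
allPoints (suc n) = map (cons false) (allPoints n) ++ map (cons true) (allPoints n)

sumℤ : List ℤ → ℤ
sumℤ = foldr ℤ._+_ (+ 0)

sign : Bool → ℤ
sign false = + 1
sign true  = - (+ 1)

S : ∀ {n} → BoolFun n → ℤ
S {n} F = sumℤ (map (λ x → sign (F x)) (allPoints n))

-- index t taken modulo (suc m), as an element of Fin (suc m)
-- (0-based: variable X_{j+1} is position j)
cyc : (m : ℕ) → ℕ → Fin (suc m)
cyc m t = fromℕ< (m%n<n t (suc m))

cycMonomial : (k m : ℕ) → Fin (suc m) → BoolFun (suc m)
cycMonomial k m i x = foldr _∧_ true (map (λ j → x (cyc m (toℕ i + j))) (upTo k))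

-- R_{2,3,…,k}(n) = Σ_{i=1}^{n} X_i X_{i+1} ⋯ X_{i+k-1}  (sum in F₂ = xor).
-- For n = 0 there are no variables and the (empty) sum is 0.
R : (k n : ℕ) → BoolFun n
R k zero x = false
R k (suc m) x = foldr _xor_ false (map (λ i → cycMonomial k m i x) (allFin (suc m)))

-- The sequence a(n) = S(R_{2,…,k}(n)) (meaningful for n ≥ k)
seqS : ℕ → ℕ → ℤ
seqS k n = S (R k n)

sumFrom1 : ℕ → (ℕ → ℤ) → ℤ
sumFrom1 d f = sumℤ (map (λ j → f (suc j)) (upTo d))

-- The sequence (a n)_{n ≥ n₀} satisfies the homogeneous linear recurrence with
-- characteristic polynomial X^d − Σ_{i=1}^{d} c_i X^{d−i}:
-- a n = Σ_{i=1}^{d} c_i a (n−i) for every admissible n (all indices ≥ n₀).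
SatisfiesRecurrence : (d : ℕ) → (c : ℕ → ℤ) → (n₀ : ℕ) → (a : ℕ → ℤ) → Set
SatisfiesRecurrence d c n₀ a =
  ∀ n → n₀ + d ≤ n → a n ≡ sumFrom1 d (λ i → c i * a (n ∸ i))

-- Coefficients of p_k(X) = X^k − 2(X^{k−2} + ⋯ + X + 1):
-- c_1 = 0, c_i = 2 for 2 ≤ i ≤ k.
pCoeff : ℕ → ℤ
pCoeff i = if i ≡ᵇ 1 then + 0 else + 2

-- Write k = K + 1. Reading a word letter by letter, the parity of the number of
-- occurrences of the block 1ᵏ is computed by an automaton whose state is the
-- length of the current run of ones: reading a 1 in a state s ≥ K completes an
-- occurrence. Cutting a cyclic word of length K + M into its first K letters u
-- and the remaining M letters y, S(R(K + M)) becomes a sum over u of the signed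
-- counts h_s(M) of words y read from the state s reached after u. Splitting off
-- the first letter of y gives the linear system
--   h_s(M + 1) = h_0(M) ± h_{s+1}(M),   h_{K+1} = h_K,
-- with sign − exactly for s ≥ K, whose characteristic polynomial is p_k. Hence
-- every h_s, and with it S(R(n)), satisfies the recurrence.
module Submission where

open import Defs
open import Data.Bool using (Bool; true; false; _∧_; _xor_)
open import Data.Bool.Properties using (∧-zeroʳ; xor-assoc; xor-comm; xor-identityʳ)
open import Data.Fin using (Fin; toℕ)
open import Data.Fin.Properties using (toℕ-injective; toℕ-fromℕ<; toℕ<n)
open import Data.Integer using (ℤ; +_; -_; _+_; _*_; _-_)
import Data.Integer.Properties as ℤ
open import Data.Integer.Tactic.RingSolver using (solve-∀)
open import Data.List
  using (List; []; _∷_; _++_; map; foldr; length; take; replicate; applyUpTo; upTo; tabulate)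
open import Data.List.Properties
  using ( map-tabulate; map-upTo; map-++; map-∘; tabulate-cong; ++-identityʳ; ++-assoc
        ; length-replicate; length-applyUpTo )
open import Data.Nat using (ℕ; zero; suc; _≤_; _<_; z≤n; s≤s; _∸_) renaming (_+_ to _+ℕ_)
import Data.Nat.Properties as ℕ
open import Data.Nat.DivMod using (_%_; [m+n]%n≡m%n; m<n⇒m%n≡m)
open import Data.Product using (_,_)
open import Function using (id; _∘_)
open import Relation.Binary.PropositionalEquality
  using (_≡_; _≗_; refl; sym; trans; cong; cong₂; subst; module ≡-Reasoning)

open ≡-Reasoning

Σ< : ℕ → (ℕ → ℤ) → ℤ
Σ< n f = sumℤ (applyUpTo f n)

Σ<-cong : ∀ n {f g : ℕ → ℤ} → (∀ t → t < n → f t ≡ g t) → Σ< n f ≡ Σ< n g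
Σ<-cong zero    f≡g = refl
Σ<-cong (suc n) f≡g =
  cong₂ _+_ (f≡g 0 (s≤s z≤n)) (Σ<-cong n (λ t t<n → f≡g (suc t) (s≤s t<n)))

Σ<-snoc : ∀ n (f : ℕ → ℤ) → Σ< (suc n) f ≡ Σ< n f + f n
Σ<-snoc zero    f = ℤ.+-comm (f 0) (+ 0)
Σ<-snoc (suc n) f = trans (cong (_+_ (f 0)) (Σ<-snoc n (f ∘ suc))) (sym (ℤ.+-assoc (f 0) _ _))

Σ<-+ : ∀ n (f g : ℕ → ℤ) → Σ< n (λ t → f t + g t) ≡ Σ< n f + Σ< n g
Σ<-+ zero    f g = refl
Σ<-+ (suc n) f g =
  trans (cong (_+_ (f 0 + g 0)) (Σ<-+ n (f ∘ suc) (g ∘ suc))) (interchange (f 0) (g 0) _ _)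
  where
  interchange : ∀ a b c d → (a + b) + (c + d) ≡ (a + c) + (b + d)
  interchange = solve-∀

Σ<-* : ∀ n c (f : ℕ → ℤ) → Σ< n (λ t → c * f t) ≡ c * Σ< n f
Σ<-* zero    c f = sym (ℤ.*-zeroʳ c)
Σ<-* (suc n) c f = trans (cong (_+_ (c * f 0)) (Σ<-* n c (f ∘ suc))) (sym (ℤ.*-distribˡ-+ c (f 0) _))

Σ<-reverse : ∀ n (f : ℕ → ℤ) → Σ< n f ≡ Σ< n (λ j → f (n ∸ suc j))
Σ<-reverse zero    f = refl
Σ<-reverse (suc n) f = begin
  Σ< (suc n) f                          ≡⟨ Σ<-snoc n f ⟩
  Σ< n f + f n                          ≡⟨ cong (_+ f n) (Σ<-reverse n f) ⟩
  Σ< n (λ j → f (n ∸ suc j)) + f n      ≡⟨ ℤ.+-comm _ (f n) ⟩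
  f n + Σ< n (λ j → f (n ∸ suc j))      ∎

sumFrom1-pCoeff : ∀ K (f : ℕ → ℤ) →
                  sumFrom1 (suc K) (λ i → pCoeff i * f i) ≡ + 2 * Σ< K (λ j → f (suc (suc j)))
sumFrom1-pCoeff K f = begin
  sumFrom1 (suc K) (λ i → pCoeff i * f i)
    ≡⟨ cong sumℤ (map-upTo (λ j → pCoeff (suc j) * f (suc j)) (suc K)) ⟩
  + 0 * f 1 + Σ< K (λ j → + 2 * f (suc (suc j)))        ≡⟨ ℤ.+-identityˡ _ ⟩
  Σ< K (λ j → + 2 * f (suc (suc j)))                    ≡⟨ Σ<-* K (+ 2) _ ⟩
  + 2 * Σ< K (λ j → f (suc (suc j)))                    ∎

sumℤ-++ : ∀ (xs ys : List ℤ) → sumℤ (xs ++ ys) ≡ sumℤ xs + sumℤ ys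
sumℤ-++ []       ys = sym (ℤ.+-identityˡ _)
sumℤ-++ (x ∷ xs) ys = trans (cong (_+_ x) (sumℤ-++ xs ys)) (sym (ℤ.+-assoc x _ _))

sumWords : ℕ → (List Bool → ℤ) → ℤ
sumWords zero    G = G []
sumWords (suc n) G = sumWords n (G ∘ (false ∷_)) + sumWords n (G ∘ (true ∷_))

sumWords-cong : ∀ n {G G′ : List Bool → ℤ} →
                (∀ w → length w ≡ n → G w ≡ G′ w) → sumWords n G ≡ sumWords n G′
sumWords-cong zero    G≡G′ = G≡G′ [] refl
sumWords-cong (suc n) G≡G′ =
  cong₂ _+_ (sumWords-cong n (λ w |w|≡n → G≡G′ (false ∷ w) (cong suc |w|≡n)))
            (sumWords-cong n (λ w |w|≡n → G≡G′ (true ∷ w) (cong suc |w|≡n)))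

sumWords-* : ∀ n c (G : List Bool → ℤ) → sumWords n (λ w → c * G w) ≡ c * sumWords n G
sumWords-* zero    c G = refl
sumWords-* (suc n) c G =
  trans (cong₂ _+_ (sumWords-* n c _) (sumWords-* n c _)) (sym (ℤ.*-distribˡ-+ c _ _))

sumWords-++ : ∀ m n (G : List Bool → ℤ) →
              sumWords (m +ℕ n) G ≡ sumWords m (λ u → sumWords n (λ y → G (u ++ y)))
sumWords-++ zero    n G = refl
sumWords-++ (suc m) n G = cong₂ _+_ (sumWords-++ m n _) (sumWords-++ m n _)

sum-allPoints : ∀ n (H : Point n → ℤ) {G : List Bool → ℤ} →
                (∀ x → H x ≡ G (tabulate x)) → sumℤ (map H (allPoints n)) ≡ sumWords n G
sum-allPoints zero    H H≡G = trans (ℤ.+-identityʳ _) (H≡G _)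
sum-allPoints (suc n) H {G} H≡G = begin
  sumℤ (map H (map (cons false) ps ++ map (cons true) ps))
    ≡⟨ cong sumℤ (map-++ H (map (cons false) ps) _) ⟩
  sumℤ (map H (map (cons false) ps) ++ map H (map (cons true) ps))
    ≡⟨ sumℤ-++ (map H (map (cons false) ps)) _ ⟩
  sumℤ (map H (map (cons false) ps)) + sumℤ (map H (map (cons true) ps))
    ≡⟨ cong₂ _+_ (half false) (half true) ⟩
  sumWords (suc n) G ∎
  where
  ps : List (Point n)
  ps = allPoints n
  half : ∀ b → sumℤ (map H (map (cons b) ps)) ≡ sumWords n (G ∘ (b ∷_))
  half b = trans (cong sumℤ (sym (map-∘ ps)))
                 (sum-allPoints n (H ∘ cons b) (H≡G ∘ cons b))

module Recurrence (K : ℕ) where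

  record Recurrent (f : ℕ → ℤ) : Set where
    constructor mkRecurrent
    field
      recurrence : ∀ L → f (suc K +ℕ L) ≡ + 2 * Σ< K (λ t → f (t +ℕ L))

  open Recurrent

  Recurrent-cong : ∀ {f g} → f ≗ g → Recurrent f → Recurrent g
  Recurrent-cong f≗g rec = mkRecurrent λ L →
    trans (sym (f≗g _)) (trans (recurrence rec L) (cong (+ 2 *_) (Σ<-cong K (λ t _ → f≗g (t +ℕ L)))))

  Recurrent-shift : ∀ {f} → Recurrent f → Recurrent (f ∘ suc)
  Recurrent-shift {f} rec = mkRecurrent λ L → begin
    f (suc (suc K +ℕ L))                 ≡⟨ cong f (sym (ℕ.+-suc (suc K) L)) ⟩
    f (suc K +ℕ suc L)                   ≡⟨ recurrence rec (suc L) ⟩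
    + 2 * Σ< K (λ t → f (t +ℕ suc L))
      ≡⟨ cong (+ 2 *_) (Σ<-cong K (λ t _ → cong f (ℕ.+-suc t L))) ⟩
    + 2 * Σ< K (λ t → f (suc (t +ℕ L)))  ∎

  Recurrent-+ : ∀ {f g} → Recurrent f → Recurrent g → Recurrent (λ M → f M + g M)
  Recurrent-+ {f} {g} recf recg = mkRecurrent λ L →
    let f′ = λ t → f (t +ℕ L); g′ = λ t → g (t +ℕ L) in begin
    f (suc K +ℕ L) + g (suc K +ℕ L)  ≡⟨ cong₂ _+_ (recurrence recf L) (recurrence recg L) ⟩
    + 2 * Σ< K f′ + + 2 * Σ< K g′    ≡⟨ sym (ℤ.*-distribˡ-+ (+ 2) (Σ< K f′) (Σ< K g′)) ⟩
    + 2 * (Σ< K f′ + Σ< K g′)        ≡⟨ cong (+ 2 *_) (sym (Σ<-+ K f′ g′)) ⟩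
    + 2 * Σ< K (λ t → f′ t + g′ t)   ∎

  Recurrent-* : ∀ c {f} → Recurrent f → Recurrent (λ M → c * f M)
  Recurrent-* c {f} rec = mkRecurrent λ L → begin
    c * f (suc K +ℕ L)                       ≡⟨ cong (c *_) (recurrence rec L) ⟩
    c * (+ 2 * Σ< K (λ t → f (t +ℕ L)))      ≡⟨ swap c _ ⟩
    + 2 * (c * Σ< K (λ t → f (t +ℕ L)))      ≡⟨ cong (+ 2 *_) (sym (Σ<-* K c _)) ⟩
    + 2 * Σ< K (λ t → c * f (t +ℕ L))        ∎
    where
    swap : ∀ c a → c * (+ 2 * a) ≡ + 2 * (c * a)
    swap = solve-∀

  Recurrent-sumWords : ∀ n (H : List Bool → ℕ → ℤ) →
                       (∀ u → Recurrent (H u)) → Recurrent (λ M → sumWords n (λ u → H u M))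
  Recurrent-sumWords zero    H rec = rec []
  Recurrent-sumWords (suc n) H rec =
    Recurrent-+ (Recurrent-sumWords n (H ∘ (false ∷_)) (rec ∘ (false ∷_)))
                (Recurrent-sumWords n (H ∘ (true ∷_)) (rec ∘ (true ∷_)))

  module TransferSystem
    (σ : ℕ → ℤ) (σ-< : ∀ s → s < K → σ s ≡ + 1) (σ-K : σ K ≡ - + 1)
    (σ*σ : ∀ s → σ s * σ s ≡ + 1)
    (h : ℕ → ℕ → ℤ)
    (h-step : ∀ s L → h s (suc L) ≡ h 0 L + σ s * h (suc s) L)
    (h-saturated : ∀ L → h (suc K) L ≡ h K L)
    where

    telescope : ∀ j s → s +ℕ j ≡ K → ∀ L →
                h s (j +ℕ L) ≡ Σ< j (λ t → h 0 (t +ℕ L)) + h K L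
    telescope zero    s s+0≡K L =
      trans (cong (λ s′ → h s′ L) (trans (sym (ℕ.+-identityʳ s)) s+0≡K))
            (sym (ℤ.+-identityˡ (h K L)))
    telescope (suc j) s s+j+1≡K L = begin
      h s (suc (j +ℕ L))                       ≡⟨ h-step s (j +ℕ L) ⟩
      h 0 (j +ℕ L) + σ s * h (suc s) (j +ℕ L)
        ≡⟨ cong₂ (λ c x → h 0 (j +ℕ L) + c * x) (σ-< s s<K) (telescope j (suc s) s+1+j≡K L) ⟩
      h 0 (j +ℕ L) + + 1 * (Σ< j h₀ + h K L)   ≡⟨ regroup (h 0 (j +ℕ L)) (Σ< j h₀) (h K L) ⟩
      (Σ< j h₀ + h 0 (j +ℕ L)) + h K L         ≡⟨ cong (_+ h K L) (sym (Σ<-snoc j h₀)) ⟩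
      Σ< (suc j) h₀ + h K L                    ∎
      where
      h₀ : ℕ → ℤ
      h₀ t = h 0 (t +ℕ L)
      s+1+j≡K : suc s +ℕ j ≡ K
      s+1+j≡K = trans (sym (ℕ.+-suc s j)) s+j+1≡K
      s<K : s < K
      s<K = subst (s <_) s+j+1≡K (ℕ.m<m+n s (s≤s z≤n))
      regroup : ∀ a b c → a + + 1 * (b + c) ≡ (b + a) + c
      regroup = solve-∀

    h-K-step : ∀ L → h K (suc L) ≡ h 0 L - h K L
    h-K-step L = begin
      h K (suc L)                         ≡⟨ h-step K L ⟩
      h 0 L + σ K * h (suc K) L           ≡⟨ cong₂ (λ c x → h 0 L + c * x) σ-K (h-saturated L) ⟩
      h 0 L + - + 1 * h K L               ≡⟨ cong (_+_ (h 0 L)) (ℤ.-1*i≡-i (h K L)) ⟩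
      h 0 L - h K L                       ∎

    -- Writing A for the window sum of h₀ at L, telescoping gives h₀(K + L) = A + h_K(L);
    -- one step later the window has moved by one and h_K has flipped sign.
    head-recurrent : Recurrent (h 0)
    head-recurrent = mkRecurrent λ L → let h₀ = λ t → h 0 (t +ℕ L) in begin
      h 0 (suc K +ℕ L)                      ≡⟨ cong (h 0) (sym (ℕ.+-suc K L)) ⟩
      h 0 (K +ℕ suc L)                      ≡⟨ telescope K 0 refl (suc L) ⟩
      Σ< K (λ t → h 0 (t +ℕ suc L)) + h K (suc L)
        ≡⟨ cong₂ _+_ (Σ<-cong K (λ t _ → cong (h 0) (ℕ.+-suc t L))) (h-K-step L) ⟩
      Σ< K (h₀ ∘ suc) + (h 0 L - h K L)     ≡⟨ regroup (Σ< K (h₀ ∘ suc)) (h 0 L) (h K L) ⟩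
      Σ< (suc K) h₀ - h K L                 ≡⟨ cong (_- h K L) (Σ<-snoc K h₀) ⟩
      Σ< K h₀ + h 0 (K +ℕ L) - h K L
        ≡⟨ cong (λ x → Σ< K h₀ + x - h K L) (telescope K 0 refl L) ⟩
      Σ< K h₀ + (Σ< K h₀ + h K L) - h K L   ≡⟨ cancel (Σ< K h₀) (h K L) ⟩
      + 2 * Σ< K h₀                         ∎
      where
      regroup : ∀ b e d → b + (e - d) ≡ (e + b) - d
      regroup = solve-∀
      cancel : ∀ a d → a + (a + d) - d ≡ + 2 * a
      cancel = solve-∀

    all-recurrent : ∀ s → Recurrent (h s)
    all-recurrent zero    = head-recurrent
    all-recurrent (suc s) =
      Recurrent-cong unfold
        (Recurrent-* (σ s)
          (Recurrent-+ (Recurrent-shift (all-recurrent s)) (Recurrent-* (- + 1) head-recurrent)))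
      where
      unfold : ∀ M → σ s * (h s (suc M) + - + 1 * h 0 M) ≡ h (suc s) M
      unfold M = begin
        σ s * (h s (suc M) + - + 1 * h 0 M)
          ≡⟨ cong (λ x → σ s * (x + - + 1 * h 0 M)) (h-step s M) ⟩
        σ s * (h 0 M + σ s * h (suc s) M + - + 1 * h 0 M)  ≡⟨ cancel (σ s) (h 0 M) (h (suc s) M) ⟩
        σ s * σ s * h (suc s) M                            ≡⟨ cong (_* h (suc s) M) (σ*σ s) ⟩
        + 1 * h (suc s) M                                  ≡⟨ ℤ.*-identityˡ _ ⟩
        h (suc s) M                                        ∎
        where
        cancel : ∀ c a b → c * (a + c * b + - + 1 * a) ≡ c * c * b
        cancel = solve-∀

  Recurrent⇒SatisfiesRecurrence : ∀ m {a : ℕ → ℤ} →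
    Recurrent (λ M → a (m +ℕ M)) → SatisfiesRecurrence (suc K) pCoeff m a
  Recurrent⇒SatisfiesRecurrence m {a} rec n m+k≤n with ℕ.m≤n⇒∃[o]m+o≡n m+k≤n
  ... | o , refl = begin
    a (m +ℕ suc K +ℕ o)                                 ≡⟨ cong a (ℕ.+-assoc m (suc K) o) ⟩
    a (m +ℕ (suc K +ℕ o))                               ≡⟨ recurrence rec o ⟩
    + 2 * Σ< K (λ t → a (m +ℕ (t +ℕ o)))                ≡⟨ cong (+ 2 *_) (Σ<-reverse K _) ⟩
    + 2 * Σ< K (λ j → a (m +ℕ ((K ∸ suc j) +ℕ o)))
      ≡⟨ cong (+ 2 *_) (Σ<-cong K (λ j j<K → cong a (sym (index j<K)))) ⟩
    + 2 * Σ< K (λ j → a (m +ℕ suc K +ℕ o ∸ suc (suc j)))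
      ≡⟨ sym (sumFrom1-pCoeff K (λ i → a (m +ℕ suc K +ℕ o ∸ i))) ⟩
    sumFrom1 (suc K) (λ i → pCoeff i * a (m +ℕ suc K +ℕ o ∸ i)) ∎
    where
    index : ∀ {j} → j < K → m +ℕ suc K +ℕ o ∸ suc (suc j) ≡ m +ℕ ((K ∸ suc j) +ℕ o)
    index {j} j<K = begin
      m +ℕ suc K +ℕ o ∸ suc (suc j)          ≡⟨ cong (_∸ suc (suc j)) (ℕ.+-assoc m (suc K) o) ⟩
      m +ℕ (suc K +ℕ o) ∸ suc (suc j)
        ≡⟨ ℕ.+-∸-assoc m (ℕ.≤-trans (s≤s j<K) (ℕ.m≤m+n (suc K) o)) ⟩
      m +ℕ (suc K +ℕ o ∸ suc (suc j))        ≡⟨ cong (m +ℕ_) (ℕ.+-∸-comm o (s≤s j<K)) ⟩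
      m +ℕ ((K ∸ suc j) +ℕ o)                ∎

prefixOnes : ℕ → List Bool → Bool
prefixOnes zero    _       = true
prefixOnes (suc j) []      = false
prefixOnes (suc j) (b ∷ z) = b ∧ prefixOnes j z

prefixOnes-short : ∀ j z → length z < j → prefixOnes j z ≡ false
prefixOnes-short (suc j) []      _           = refl
prefixOnes-short (suc j) (b ∷ z) (s≤s |z|<j) =
  trans (cong (b ∧_) (prefixOnes-short j z |z|<j)) (∧-zeroʳ b)

prefixOnes-replicate : ∀ j s → j ≤ s → prefixOnes j (replicate s true) ≡ true
prefixOnes-replicate zero    s       _         = refl
prefixOnes-replicate (suc j) (suc s) (s≤s j≤s) = prefixOnes-replicate j s j≤s

prefixOnes-++-false : ∀ j a z → prefixOnes j (a ++ false ∷ z) ≡ prefixOnes j a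
prefixOnes-++-false zero    a       z = refl
prefixOnes-++-false (suc j) []      z = refl
prefixOnes-++-false (suc j) (c ∷ a) z = cong (c ∧_) (prefixOnes-++-false j a z)

prefixOnes-applyUpTo : ∀ j N (f : ℕ → Bool) → j ≤ N →
                       prefixOnes j (applyUpTo f N) ≡ foldr _∧_ true (applyUpTo f j)
prefixOnes-applyUpTo zero    N       f _         = refl
prefixOnes-applyUpTo (suc j) (suc N) f (s≤s j≤N) =
  cong (f 0 ∧_) (prefixOnes-applyUpTo j N (f ∘ suc) j≤N)

blockParity : ℕ → List Bool → Bool
blockParity k []      = false
blockParity k (b ∷ z) = prefixOnes k (b ∷ z) xor blockParity k z

blockParity-short : ∀ k z → length z < k → blockParity k z ≡ false
blockParity-short k []      _      = refl
blockParity-short k (b ∷ z) |bz|<k =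
  cong₂ _xor_ (prefixOnes-short k (b ∷ z) |bz|<k)
              (blockParity-short k z (ℕ.<-trans (ℕ.n<1+n _) |bz|<k))

blockParity-++-false : ∀ K a z →
  blockParity (suc K) (a ++ false ∷ z) ≡ blockParity (suc K) a xor blockParity (suc K) z
blockParity-++-false K []      z = refl
blockParity-++-false K (c ∷ a) z =
  trans (cong₂ _xor_ (cong (c ∧_) (prefixOnes-++-false K a z)) (blockParity-++-false K a z))
        (sym (xor-assoc (c ∧ prefixOnes K a) _ _))

replicate-++-∷ : ∀ {A : Set} n (x : A) xs → replicate n x ++ x ∷ xs ≡ x ∷ replicate n x ++ xs
replicate-++-∷ zero    x xs = refl
replicate-++-∷ (suc n) x xs = cong (x ∷_) (replicate-++-∷ n x xs)

take-length-++ : ∀ {A : Set} (xs ys : List A) → take (length xs) (xs ++ ys) ≡ xs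
take-length-++ []       ys = refl
take-length-++ (x ∷ xs) ys = cong (x ∷_) (take-length-++ xs ys)

sign-xor : ∀ a b → sign (a xor b) ≡ sign a * sign b
sign-xor false false = refl
sign-xor false true  = refl
sign-xor true  false = refl
sign-xor true  true  = refl

sign*sign≡1 : ∀ b → sign b * sign b ≡ + 1
sign*sign≡1 false = refl
sign*sign≡1 true  = refl

-- With k = K + 1, parityFrom s w is the parity of the occurrences of 1ᵏ in 1ˢ w that end inside w;
-- stateAfter s w is the length of the final run of ones in 1ˢ w.
module Automaton (K : ℕ) where

  completes : ℕ → Bool
  completes s = prefixOnes (suc K) (replicate (suc s) true)

  parityFrom : ℕ → List Bool → Bool
  parityFrom s []          = false
  parityFrom s (false ∷ w) = parityFrom 0 w
  parityFrom s (true ∷ w)  = completes s xor parityFrom (suc s) w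

  stateAfter : ℕ → List Bool → ℕ
  stateAfter s []          = s
  stateAfter s (false ∷ w) = stateAfter 0 w
  stateAfter s (true ∷ w)  = stateAfter (suc s) w

  completes-< : ∀ s → s < K → completes s ≡ false
  completes-< s s<K = prefixOnes-short (suc K) (replicate (suc s) true)
    (subst (_< suc K) (sym (length-replicate (suc s))) (s≤s s<K))

  completes-≥ : ∀ s → K ≤ s → completes s ≡ true
  completes-≥ s K≤s = prefixOnes-replicate (suc K) (suc s) (s≤s K≤s)

  parityFrom-++ : ∀ s a b → parityFrom s (a ++ b) ≡ parityFrom s a xor parityFrom (stateAfter s a) b
  parityFrom-++ s []          b = refl
  parityFrom-++ s (false ∷ a) b = parityFrom-++ 0 a b
  parityFrom-++ s (true ∷ a)  b =
    trans (cong (completes s xor_) (parityFrom-++ (suc s) a b)) (sym (xor-assoc (completes s) _ _))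

  parityFrom-saturated : ∀ s s′ w → K ≤ s → K ≤ s′ → parityFrom s w ≡ parityFrom s′ w
  parityFrom-saturated s s′ []          _   _    = refl
  parityFrom-saturated s s′ (false ∷ w) _   _    = refl
  parityFrom-saturated s s′ (true ∷ w)  K≤s K≤s′ =
    cong₂ _xor_ (trans (completes-≥ s K≤s) (sym (completes-≥ s′ K≤s′)))
      (parityFrom-saturated (suc s) (suc s′) w (ℕ.m≤n⇒m≤1+n K≤s) (ℕ.m≤n⇒m≤1+n K≤s′))

  blockParity-ones-++ : ∀ z s →
    blockParity (suc K) (replicate s true ++ z) ≡ blockParity (suc K) (replicate s true) xor parityFrom s z
  blockParity-ones-++ []          s =
    trans (cong (blockParity (suc K)) (++-identityʳ (replicate s true))) (sym (xor-identityʳ _))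
  blockParity-ones-++ (false ∷ z) s =
    trans (blockParity-++-false K (replicate s true) z)
          (cong (blockParity (suc K) (replicate s true) xor_) (blockParity-ones-++ z 0))
  blockParity-ones-++ (true ∷ z)  s = begin
    blockParity (suc K) (replicate s true ++ true ∷ z)
      ≡⟨ cong (blockParity (suc K)) (replicate-++-∷ s true z) ⟩
    blockParity (suc K) (replicate (suc s) true ++ z)
      ≡⟨ blockParity-ones-++ z (suc s) ⟩
    (completes s xor blockParity (suc K) (replicate s true)) xor parityFrom (suc s) z
      ≡⟨ cong (_xor parityFrom (suc s) z) (xor-comm (completes s) _) ⟩
    (blockParity (suc K) (replicate s true) xor completes s) xor parityFrom (suc s) z
      ≡⟨ xor-assoc (blockParity (suc K) (replicate s true)) _ _ ⟩
    blockParity (suc K) (replicate s true) xor parityFrom s (true ∷ z) ∎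

  blockParity≡parityFrom : ∀ z → blockParity (suc K) z ≡ parityFrom 0 z
  blockParity≡parityFrom z = blockParity-ones-++ z 0

  signSum : ℕ → ℕ → List Bool → ℤ
  signSum s M v = sumWords M (λ y → sign (parityFrom s (y ++ v)))

  signSum-step : ∀ s M v →
                 signSum s (suc M) v ≡ signSum 0 M v + sign (completes s) * signSum (suc s) M v
  signSum-step s M v = cong (_+_ (signSum 0 M v))
    (trans (sumWords-cong M (λ y _ → sign-xor (completes s) (parityFrom (suc s) (y ++ v))))
           (sumWords-* M (sign (completes s)) _))

  signSum-saturated : ∀ M v → signSum (suc K) M v ≡ signSum K M v
  signSum-saturated M v =
    sumWords-cong M (λ y _ →
      cong sign (parityFrom-saturated (suc K) K (y ++ v) (ℕ.n≤1+n K) ℕ.≤-refl))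

  splitSum : ℕ → ℤ
  splitSum M = sumWords K (λ u → sign (parityFrom 0 u) * signSum (stateAfter 0 u) M u)

  -- Cut the cyclic word after its first K letters u: the automaton reads u, then continues on y ++ u.
  sumWords-cut : ∀ M →
    sumWords (K +ℕ M) (λ w → sign (blockParity (suc K) (w ++ take K w)))
      ≡ splitSum M
  sumWords-cut M =
    trans (sumWords-++ K M _)
          (sumWords-cong K (λ u |u|≡K →
            trans (sumWords-cong M (λ y _ → cut u y |u|≡K)) (sumWords-* M (sign (parityFrom 0 u)) _)))
    where
    cut : ∀ u y → length u ≡ K →
          sign (blockParity (suc K) ((u ++ y) ++ take K (u ++ y)))
            ≡ sign (parityFrom 0 u) * sign (parityFrom (stateAfter 0 u) (y ++ u))
    cut u y |u|≡K = begin
      sign (blockParity (suc K) ((u ++ y) ++ take K (u ++ y)))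
        ≡⟨ cong (λ v → sign (blockParity (suc K) ((u ++ y) ++ v)))
                (subst (λ l → take l (u ++ y) ≡ u) |u|≡K (take-length-++ u y)) ⟩
      sign (blockParity (suc K) ((u ++ y) ++ u))
        ≡⟨ cong (sign ∘ blockParity (suc K)) (++-assoc u y u) ⟩
      sign (blockParity (suc K) (u ++ y ++ u))
        ≡⟨ cong sign (trans (blockParity≡parityFrom (u ++ y ++ u)) (parityFrom-++ 0 u (y ++ u))) ⟩
      sign (parityFrom 0 u xor parityFrom (stateAfter 0 u) (y ++ u))
        ≡⟨ sign-xor (parityFrom 0 u) _ ⟩
      sign (parityFrom 0 u) * sign (parityFrom (stateAfter 0 u) (y ++ u)) ∎

  open Recurrence K

  signSum-recurrent : ∀ s v → Recurrent (λ M → signSum s M v)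
  signSum-recurrent s v = TransferSystem.all-recurrent
    (sign ∘ completes) (λ s s<K → cong sign (completes-< s s<K)) (cong sign (completes-≥ K ℕ.≤-refl))
    (sign*sign≡1 ∘ completes)
    (λ s M → signSum s M v) (λ s M → signSum-step s M v) (λ M → signSum-saturated M v) s

  splitSum-recurrent : Recurrent splitSum
  splitSum-recurrent = Recurrent-sumWords K _
    (λ u → Recurrent-* (sign (parityFrom 0 u)) (signSum-recurrent (stateAfter 0 u) u))

tabulate-toℕ : ∀ {A : Set} n (f : ℕ → A) → tabulate {n = n} (f ∘ toℕ) ≡ applyUpTo f n
tabulate-toℕ zero    f = refl
tabulate-toℕ (suc n) f = cong (f 0 ∷_) (tabulate-toℕ n (f ∘ suc))

applyUpTo-cong : ∀ {A : Set} n {f g : ℕ → A} → f ≗ g → applyUpTo f n ≡ applyUpTo g n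
applyUpTo-cong zero    f≗g = refl
applyUpTo-cong (suc n) f≗g = cong₂ _∷_ (f≗g 0) (applyUpTo-cong n (f≗g ∘ suc))

applyUpTo-++ : ∀ {A : Set} m n (f : ℕ → A) →
               applyUpTo f (m +ℕ n) ≡ applyUpTo f m ++ applyUpTo (f ∘ (m +ℕ_)) n
applyUpTo-++ zero    n f = refl
applyUpTo-++ (suc m) n f = cong (f 0 ∷_) (applyUpTo-++ m n (f ∘ suc))

take-applyUpTo : ∀ {A : Set} m n (f : ℕ → A) → m ≤ n → take m (applyUpTo f n) ≡ applyUpTo f m
take-applyUpTo zero    n       f _         = refl
take-applyUpTo (suc m) (suc n) f (s≤s m≤n) = cong (f 0 ∷_) (take-applyUpTo m n (f ∘ suc) m≤n)

cyc-periodic : ∀ m t → cyc m (suc m +ℕ t) ≡ cyc m t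
cyc-periodic m t = toℕ-injective (begin
  toℕ (cyc m (suc m +ℕ t))   ≡⟨ toℕ-fromℕ< _ ⟩
  (suc m +ℕ t) % suc m       ≡⟨ cong (_% suc m) (ℕ.+-comm (suc m) t) ⟩
  (t +ℕ suc m) % suc m       ≡⟨ [m+n]%n≡m%n t (suc m) ⟩
  t % suc m                  ≡⟨ sym (toℕ-fromℕ< _) ⟩
  toℕ (cyc m t)              ∎)

cyc-toℕ : ∀ m (i : Fin (suc m)) → cyc m (toℕ i) ≡ i
cyc-toℕ m i = toℕ-injective (trans (toℕ-fromℕ< _) (m<n⇒m%n≡m (toℕ<n i)))

xor-windows : ∀ K n (f : ℕ → Bool) →
  foldr _xor_ false (applyUpTo (λ t → foldr _∧_ true (map (λ j → f (t +ℕ j)) (upTo (suc K)))) n)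
    ≡ blockParity (suc K) (applyUpTo f (n +ℕ K))
xor-windows K zero    f =
  sym (blockParity-short (suc K) (applyUpTo f K)
         (subst (_< suc K) (sym (length-applyUpTo f K)) (ℕ.n<1+n K)))
xor-windows K (suc n) f = cong₂ _xor_ first-window (xor-windows K n (f ∘ suc))
  where
  first-window : foldr _∧_ true (map f (upTo (suc K))) ≡ prefixOnes (suc K) (applyUpTo f (suc n +ℕ K))
  first-window = trans (cong (foldr _∧_ true) (map-upTo f (suc K)))
                       (sym (prefixOnes-applyUpTo (suc K) (suc n +ℕ K) f (s≤s (ℕ.m≤n+m K n))))

-- Unrolled periodically, the cyclic word w becomes w followed by its first K letters,
-- in which the cyclic windows of length K + 1 are exactly the windows starting in w.
R-cyclic : ∀ K m (x : Point (suc m)) → K ≤ suc m →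
           R (suc K) (suc m) x ≡ blockParity (suc K) (tabulate x ++ take K (tabulate x))
R-cyclic K m x K≤n = begin
  R (suc K) (suc m) x
    ≡⟨ cong (foldr _xor_ false) (map-tabulate {n = suc m} id (window ∘ toℕ)) ⟩
  foldr _xor_ false (tabulate {n = suc m} (window ∘ toℕ))
    ≡⟨ cong (foldr _xor_ false) (tabulate-toℕ (suc m) window) ⟩
  foldr _xor_ false (applyUpTo window (suc m))
    ≡⟨ xor-windows K (suc m) x̃ ⟩
  blockParity (suc K) (applyUpTo x̃ (suc m +ℕ K))
    ≡⟨ cong (blockParity (suc K)) unroll ⟩
  blockParity (suc K) (tabulate x ++ take K (tabulate x)) ∎
  where
  x̃ : ℕ → Bool
  x̃ = x ∘ cyc m
  window : ℕ → Bool
  window t = foldr _∧_ true (map (λ j → x̃ (t +ℕ j)) (upTo (suc K)))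
  one-period : applyUpTo x̃ (suc m) ≡ tabulate x
  one-period = trans (sym (tabulate-toℕ (suc m) x̃)) (tabulate-cong (cong x ∘ cyc-toℕ m))
  unroll : applyUpTo x̃ (suc m +ℕ K) ≡ tabulate x ++ take K (tabulate x)
  unroll = begin
    applyUpTo x̃ (suc m +ℕ K)
      ≡⟨ applyUpTo-++ (suc m) K x̃ ⟩
    applyUpTo x̃ (suc m) ++ applyUpTo (x̃ ∘ (suc m +ℕ_)) K
      ≡⟨ cong (applyUpTo x̃ (suc m) ++_) (applyUpTo-cong K (cong x ∘ cyc-periodic m)) ⟩
    applyUpTo x̃ (suc m) ++ applyUpTo x̃ K
      ≡⟨ cong (applyUpTo x̃ (suc m) ++_) (sym (take-applyUpTo K (suc m) x̃ K≤n)) ⟩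
    applyUpTo x̃ (suc m) ++ take K (applyUpTo x̃ (suc m))
      ≡⟨ cong (λ w → w ++ take K w) one-period ⟩
    tabulate x ++ take K (tabulate x) ∎

seqS-cyclic : ∀ K m → K ≤ suc m →
              seqS (suc K) (suc m) ≡ sumWords (suc m) (λ w → sign (blockParity (suc K) (w ++ take K w)))
seqS-cyclic K m K≤n =
  sum-allPoints (suc m) (sign ∘ R (suc K) (suc m)) {λ w → sign (blockParity (suc K) (w ++ take K w))}
    (λ x → cong sign (R-cyclic K m x K≤n))

theorem2p3 : (k : ℕ) → 2 ≤ k → SatisfiesRecurrence k pCoeff k (seqS k)
theorem2p3 (suc (suc K′)) (s≤s (s≤s z≤n)) n k+k≤n =
  Recurrent⇒SatisfiesRecurrence K {seqS (suc K)} (Recurrent-cong splitSum≡seqS splitSum-recurrent)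
    n (ℕ.<⇒≤ k+k≤n)
  where
  K : ℕ
  K = suc K′
  open Automaton K
  open Recurrence K
  splitSum≡seqS : ∀ M → splitSum M ≡ seqS (suc K) (K +ℕ M)
  splitSum≡seqS M = sym (trans (seqS-cyclic K (K′ +ℕ M) (s≤s (ℕ.m≤m+n K′ M))) (sumWords-cut M))
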